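{- Let $G=(V,E)$ be a 2-tree. Then $G$ does not contain a split independent set; that is, there is no set $S\subseteq V$ such that $S$ is independent and the induced subgraph $\langle V\setminus S\rangle$ is either disconnected or isomorphic to $K_1$.
   Context: All graphs are finite, undirected, simple (no loops or multiple edges) and connected. A 2-tree is a graph obtained from the triangle $K_3$ by repeatedly adding a new vertex adjacent to both endpoints of an existing edge. A set $S\subseteq V$ is independent if the induced subgraph $\langle S\rangle$ has no edges. A set $S\subseteq V$ is a split independent set if $S$ is independent and the induced subgraph $\langle V\setminus S\rangle$ is either disconnected or a $K_1$. -}

module Defs where

open import Data.Nat using (ℕ; suc)
open import Data.Fin using (Fin; zero; suc)
open import Data.Fin.Subset using (Subset; _∈_; ∁)
open import Data.Product using (Σ; _×_; ∃; ∃-syntax)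
open import Data.Sum using (_⊎_)
open import Data.Empty using (⊥)
open import Relation.Nullary using (¬_)
open import Relation.Binary.PropositionalEquality using (_≡_; _≢_)

record Graph : Set₁ where
  field
    n     : ℕ
    Adj   : Fin n → Fin n → Set
    sym   : ∀ {x y} → Adj x y → Adj y x
    irrefl : ∀ {x} → ¬ Adj x x
open Graph public

record _≅_ (G H : Graph) : Set where
  field
    to      : Fin (n G) → Fin (n H)
    from    : Fin (n H) → Fin (n G)
    from-to : ∀ x → from (to x) ≡ x
    to-from : ∀ y → to (from y) ≡ y
    pres    : ∀ {x y} → Adj G x y → Adj H (to x) (to y)
    refl'   : ∀ {x y} → Adj H (to x) (to y) → Adj G x y

extend : ∀ {m} → (Fin m → Fin m → Set) → Fin m → Fin m → Fin (suc m) → Fin (suc m) → Set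
extend A u v zero    zero    = ⊥
extend A u v zero    (suc y) = (y ≡ u) ⊎ (y ≡ v)
extend A u v (suc x) zero    = (x ≡ u) ⊎ (x ≡ v)
extend A u v (suc x) (suc y) = A x y

-- Adjacency relations of 2-trees built from K₃ by repeatedly adding a vertex
-- adjacent to both endpoints of an existing edge.
data TwoTreeAdj : (m : ℕ) → (Fin m → Fin m → Set) → Set₁ where
  base : TwoTreeAdj 3 (λ x y → x ≢ y)
  step : ∀ {m A} → TwoTreeAdj m A → (u v : Fin m) → A u v →
         TwoTreeAdj (suc m) (extend A u v)

IsTwoTree : Graph → Set₁
IsTwoTree G = Σ ℕ λ m → Σ (Fin m → Fin m → Set) λ A → TwoTreeAdj m A ×
  Σ (∀ {x y} → A x y → A y x) λ s → Σ (∀ {x} → ¬ A x x) λ i →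
    G ≅ record { n = m ; Adj = A ; sym = s ; irrefl = i }

Independent : (G : Graph) → Subset (n G) → Set
Independent G S = ∀ x y → x ∈ S → y ∈ S → ¬ Adj G x y

data Reach (G : Graph) (T : Subset (n G)) : Fin (n G) → Fin (n G) → Set where
  here  : ∀ {x} → x ∈ T → Reach G T x x
  there : ∀ {x y z} → x ∈ T → Adj G x y → Reach G T y z → Reach G T x z

Disconnected : (G : Graph) → Subset (n G) → Set
Disconnected G T = ∃[ x ] ∃[ y ] (x ∈ T × y ∈ T × ¬ Reach G T x y)

IsK1 : (G : Graph) → Subset (n G) → Set
IsK1 G T = ∃[ x ] (x ∈ T × (∀ y → y ∈ T → y ≡ x))

SplitIndependent : (G : Graph) → Subset (n G) → Set
SplitIndependent G S = Independent G S × (Disconnected G (∁ S) ⊎ IsK1 G (∁ S))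

-- The complement K of an independent set is a vertex cover, so it suffices that in a 2-tree
-- every vertex cover induces a connected subgraph with at least two vertices. Both facts go
-- by induction along the construction: a cover of the extended graph restricts to a cover
-- of the old one, and it contains an endpoint w of the edge uv to which the new vertex was
-- attached, so the new vertex (if kept) joins the old connected part through w. In K₃ a
-- cover must contain two of the three vertices.
module Submission where

open import Defs
open import Data.Fin using (Fin; zero; suc)
open import Data.Fin.Properties using (_≟_; suc-injective)
open import Data.Fin.Subset using (Subset; _∈_; ∁)
open import Data.Fin.Subset.Properties using (_∈?_; x∉p⇒x∈∁p)
open import Data.Nat as ℕ using (ℕ)
open import Data.Product using (Σ; ∃₂; _×_; _,_)
open import Data.Sum using (_⊎_; inj₁; inj₂)
open import Function using (_∘_)
open import Relation.Binary.Construct.Closure.ReflexiveTransitive using (Star; ε; _◅_; _◅◅_; gmap)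
open import Relation.Binary.PropositionalEquality
  using (_≡_; _≢_; refl; cong; subst; subst₂; trans) renaming (sym to ≡-sym)
open import Relation.Nullary using (¬_; yes; no)

Induced : {V : Set} → (V → V → Set) → (V → Set) → V → V → Set
Induced A K x y = K x × A x y × K y

VertexCover : {V : Set} → (V → V → Set) → (V → Set) → Set
VertexCover A K = ∀ {x y} → A x y → K x ⊎ K y

InducesConnected : {V : Set} → (V → V → Set) → (V → Set) → Set
InducesConnected A K = ∀ {x y} → K x → K y → Star (Induced A K) x y

HasTwoElements : {V : Set} → (V → Set) → Set
HasTwoElements K = ∃₂ λ x y → x ≢ y × K x × K y

independent⇒∁-vertexCover : ∀ G {S} → Independent G S → VertexCover (Adj G) (_∈ ∁ S)
independent⇒∁-vertexCover G {S} indep {x} {y} e with x ∈? S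
... | yes x∈S = inj₂ (x∉p⇒x∈∁p λ y∈S → indep x y x∈S y∈S e)
... | no  x∉S = inj₁ (x∉p⇒x∈∁p x∉S)

star⇒reach : ∀ G {T x y} → x ∈ T → Star (Induced (Adj G) (_∈ T)) x y → Reach G T x y
star⇒reach G x∈T ε                  = here x∈T
star⇒reach G x∈T ((_ , e , y∈T) ◅ p) = there x∈T e (star⇒reach G y∈T p)

module _ {m : ℕ} {A : Fin m → Fin m → Set} where

  vertexCover-endpoint : ∀ {K u v} → VertexCover A K → A u v →
                         Σ (Fin m) λ w → ((w ≡ u) ⊎ (w ≡ v)) × K w
  vertexCover-endpoint {u = u} {v} cover e with cover e
  ... | inj₁ Ku = u , inj₁ refl , Ku
  ... | inj₂ Kv = v , inj₂ refl , Kv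

  lift-induced : ∀ {u v} {K : Fin (ℕ.suc m) → Set} {x y} → Star (Induced A (K ∘ suc)) x y →
                 Star (Induced (extend A u v) K) (suc x) (suc y)
  lift-induced = gmap suc (λ edge → edge)

twoTree-vertexCover-connected : ∀ {m A K} → TwoTreeAdj m A → VertexCover A K → InducesConnected A K
twoTree-vertexCover-connected base _ {x} {y} Kx Ky with x ≟ y
... | yes refl = ε
... | no  x≢y  = (Kx , x≢y , Ky) ◅ ε
twoTree-vertexCover-connected {K = K} (step {A = A} t u v e) cover = connected
  where
  old : InducesConnected A (K ∘ suc)
  old = twoTree-vertexCover-connected t cover

  connected : InducesConnected (extend A u v) K
  connected {zero}  {zero}  _  _  = ε
  connected {suc x} {suc y} Kx Ky = lift-induced (old Kx Ky)
  connected {zero}  {suc y} K0 Ky with vertexCover-endpoint cover e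
  ... | w , w∈uv , Kw = (K0 , w∈uv , Kw) ◅ lift-induced (old Kw Ky)
  connected {suc x} {zero}  Kx K0 with vertexCover-endpoint cover e
  ... | w , w∈uv , Kw = lift-induced (old Kx Kw) ◅◅ ((Kw , w∈uv , K0) ◅ ε)

twoTree-vertexCover-hasTwoElements : ∀ {m A K} → TwoTreeAdj m A → VertexCover A K → HasTwoElements K
twoTree-vertexCover-hasTwoElements {K = K} base cover
  with cover {zero} {suc zero} (λ ()) | cover {suc zero} {suc (suc zero)} (λ ())
     | cover {zero} {suc (suc zero)} (λ ())
... | inj₁ K0 | inj₁ K1 | _       = _ , _ , (λ ()) , K0 , K1
... | inj₁ K0 | inj₂ K2 | _       = _ , _ , (λ ()) , K0 , K2
... | inj₂ K1 | _       | inj₁ K0 = _ , _ , (λ ()) , K1 , K0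
... | inj₂ K1 | _       | inj₂ K2 = _ , _ , (λ ()) , K1 , K2
twoTree-vertexCover-hasTwoElements (step t u v e) cover
  with twoTree-vertexCover-hasTwoElements t cover
... | x , y , x≢y , Kx , Ky = suc x , suc y , x≢y ∘ suc-injective , Kx , Ky

module _ {G H : Graph} (iso : G ≅ H) where
  open _≅_ iso

  ≅-reflect-adj : ∀ {a b} → Adj H a b → Adj G (from a) (from b)
  ≅-reflect-adj e = refl' (subst₂ (Adj H) (≡-sym (to-from _)) (≡-sym (to-from _)) e)

  ≅-vertexCover : ∀ {K} → VertexCover (Adj G) K → VertexCover (Adj H) (K ∘ from)
  ≅-vertexCover cover = cover ∘ ≅-reflect-adj

  ≅-connected : ∀ {K} → InducesConnected (Adj H) (K ∘ from) → InducesConnected (Adj G) K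
  ≅-connected {K} connected {x} {y} Kx Ky =
    subst₂ (Star (Induced (Adj G) K)) (from-to x) (from-to y)
      (gmap from (λ (Ka , e , Kb) → Ka , ≅-reflect-adj e , Kb)
        (connected (subst K (≡-sym (from-to x)) Kx) (subst K (≡-sym (from-to y)) Ky)))

  ≅-hasTwoElements : ∀ {K} → HasTwoElements (K ∘ from) → HasTwoElements K
  ≅-hasTwoElements (a , b , a≢b , Ka , Kb) =
    from a , from b , (λ eq → a≢b (trans (≡-sym (to-from a)) (trans (cong to eq) (to-from b)))) , Ka , Kb

mainTheorem1 : (G : Graph) → IsTwoTree G → ¬ Σ (Subset (n G)) (λ S → SplitIndependent G S)
mainTheorem1 G (_ , A , twoTree , _ , _ , iso) (S , indep , split) = refute split
  where
  cover : VertexCover A (λ a → _≅_.from iso a ∈ ∁ S)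
  cover = ≅-vertexCover iso (independent⇒∁-vertexCover G indep)

  connected : InducesConnected (Adj G) (_∈ ∁ S)
  connected = ≅-connected iso (twoTree-vertexCover-connected twoTree cover)

  refute : ¬ (Disconnected G (∁ S) ⊎ IsK1 G (∁ S))
  refute (inj₁ (x , y , x∈T , y∈T , ¬reach)) = ¬reach (star⇒reach G x∈T (connected x∈T y∈T))
  refute (inj₂ (c , _ , only-c)) with ≅-hasTwoElements iso (twoTree-vertexCover-hasTwoElements twoTree cover)
  ... | x , y , x≢y , x∈T , y∈T = x≢y (trans (only-c x x∈T) (≡-sym (only-c y y∈T)))
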